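{- For every finite, connected, loopless graph $G$ (parallel edges allowed), the folding number of $G$ equals its chromatic number: $f(G)=\chi(G)$.
   Context: All graphs are finite, undirected, loopless, connected, and may have parallel edges. A graph is complete if there is at least one edge between every pair of distinct vertices. Foldings are defined recursively: $G$ is a folding of itself; and if $G$ is not complete and $G'$ is obtained from $G$ by identifying two vertices at distance exactly $2$ in $G$ (the new vertex is adjacent to every vertex adjacent to either of them, keeping all edges, so parallel edges may arise), then every folding of $G'$ is a folding of $G$. The folding number $f(G)$ is the minimum number of vertices of a complete graph that is a folding of $G$. $\chi(G)$ denotes the chromatic number of $G$. -}

module Defs where

open import Data.Nat using (ℕ; zero; suc; _<_; _≤_)
open import Data.Fin using (Fin; punchOut; _≟_)
open import Data.List using (map; allFin)
open import Data.Nat.ListAction using (sum)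
open import Data.Product using (Σ; ∃; _×_; _,_)
open import Data.Bool using (if_then_else_)
open import Relation.Nullary using (¬_; yes; no; does)
open import Relation.Binary.PropositionalEquality using (_≡_; _≢_; sym)

-- A (multi)graph on vertex set Fin n, given by edge multiplicities:
-- mult i j = number of (parallel) edges between i and j.
Mult : ℕ → Set
Mult n = Fin n → Fin n → ℕ

IsGraph : ∀ {n} → Mult n → Set
IsGraph {n} G = (∀ i j → G i j ≡ G j i) × (∀ i → G i i ≡ 0)

Adj : ∀ {n} → Mult n → Fin n → Fin n → Set
Adj G i j = 0 < G i j

data Reach {n} (G : Mult n) : Fin n → Fin n → Set where
  here : ∀ {i} → Reach G i i
  step : ∀ {i k j} → Adj G i k → Reach G k j → Reach G i j

Connected : ∀ {n} → Mult n → Set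
Connected {n} G = ∀ (i j : Fin n) → Reach G i j

Complete : ∀ {n} → Mult n → Set
Complete {n} G = ∀ (i j : Fin n) → i ≢ j → Adj G i j

Dist2 : ∀ {n} → Mult n → Fin n → Fin n → Set
Dist2 {n} G i j = i ≢ j × ¬ Adj G i j × ∃ λ (k : Fin n) → Adj G i k × Adj G k j

ΣFin : ∀ n → (Fin n → ℕ) → ℕ
ΣFin n f = sum (map f (allFin n))

-- quotient map Fin (suc m) → Fin m sending j to (the image of) i,
-- and every other vertex to its own image
mergeMap : ∀ {m} (i j : Fin (suc m)) → i ≢ j → Fin (suc m) → Fin m
mergeMap i j i≢j x with x ≟ j
... | yes _ = punchOut {i = j} {j = i} (λ e → i≢j (sym e))
... | no x≢j = punchOut {i = j} {j = x} (λ e → x≢j (sym e))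

-- identify i and j, keeping all edges (multiplicities add up)
merge : ∀ {m} (G : Mult (suc m)) (i j : Fin (suc m)) → i ≢ j → Mult m
merge {m} G i j i≢j u v =
  ΣFin (suc m) λ x → ΣFin (suc m) λ y →
    if does (mergeMap i j i≢j x ≟ u)
    then (if does (mergeMap i j i≢j y ≟ v) then G x y else 0)
    else 0

data Folding : ∀ {n k} → Mult n → Mult k → Set where
  fold-refl : ∀ {n} {G : Mult n} → Folding G G
  fold-step : ∀ {m k} {G : Mult (suc m)} {H : Mult k} →
              ¬ Complete G → (i j : Fin (suc m)) (d : Dist2 G i j) →
              Folding (merge G i j (Data.Product.proj₁ d)) H → Folding G H

HasCompleteFolding : ∀ {n} → Mult n → ℕ → Set
HasCompleteFolding G k = Σ (Mult k) λ H → Folding G H × Complete H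

IsFoldingNumber : ∀ {n} → Mult n → ℕ → Set
IsFoldingNumber G k =
  HasCompleteFolding G k × (∀ k' → HasCompleteFolding G k' → k ≤ k')

ProperColouring : ∀ {n} → Mult n → ℕ → Set
ProperColouring {n} G k =
  Σ (Fin n → Fin k) λ c → ∀ i j → Adj G i j → c i ≢ c j

IsChromaticNumber : ∀ {n} → Mult n → ℕ → Set
IsChromaticNumber G k =
  ProperColouring G k × (∀ k' → ProperColouring G k' → k ≤ k')

module Submission where

-- Easy inequality f(G) ≥ χ(G): merging two non-adjacent vertices never
-- creates a loop, so every folding H of G is loopless; colouring each
-- vertex of H by itself and pulling back along the quotient maps gives a
-- proper colouring of G with as many colours as H has vertices.
--
-- Hard inequality f(G) ≤ χ(G): starting from a proper k-colouring of a
-- connected non-complete graph we always find a pair at distance 2 with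
-- equal colours (a recolouring lemma, possibly changing the colouring);
-- merging that pair keeps the graph connected and the colouring proper.
-- Iterating yields a complete folding carrying a proper k-colouring, and a
-- complete graph with a proper k-colouring has at most k vertices.

open import Defs
open import Data.Nat using (ℕ; zero; suc; _<_; _≤_; z≤n; s≤s)
open import Data.Nat.Properties using (m≤m+n; m≤n+m; ≤-trans; <-≤-trans; _<?_; ≮⇒≥)
open import Data.Nat.Induction using (<-rec)
open import Data.Nat.ListAction using (sum)
open import Data.Fin using (Fin; punchIn; toℕ; fromℕ<; _≟_)
import Data.Fin as Fin
open import Data.Fin.Properties
  using (any?; all?; ¬∀⟶∃¬; injective⇒≤; punchIn-punchOut; punchInᵢ≢i; punchIn-injective; toℕ<n; toℕ-fromℕ<)
open import Data.Vec.Functional using () renaming (_∷_ to _◂_)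
open import Data.List using (_∷_; map; allFin)
open import Data.List.Membership.Propositional using (_∈_)
open import Data.List.Membership.Propositional.Properties using (∈-allFin; ∈-map⁺; ∈-map⁻)
open import Data.List.Relation.Unary.Any using (here; there)
open import Data.Product using (Σ; ∃; ∃₂; _×_; _,_; proj₁; proj₂)
open import Data.Sum using (_⊎_; inj₁; inj₂)
open import Data.Bool using (if_then_else_)
open import Data.Empty using (⊥-elim)
open import Function using (_∘_)
open import Relation.Nullary using (¬_; yes; no; does; Dec)
open import Relation.Nullary.Decidable using (map′; _×-dec_; _⊎-dec_; _→-dec_; ¬?)
open import Relation.Unary using (Decidable)
open import Relation.Binary.Definitions using (Symmetric)
open import Relation.Binary.PropositionalEquality
  using (_≡_; _≢_; _≗_; refl; sym; trans; cong; subst; subst₂; module ≡-Reasoning)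

-- Multiplicities in a merged graph are double sums; we only need that each
-- summand is bounded by the sum and that a positive sum has a positive summand.
∈⇒≤sum : ∀ {n ns} → n ∈ ns → n ≤ sum ns
∈⇒≤sum {ns = m ∷ ms} (here refl) = m≤m+n m (sum ms)
∈⇒≤sum {ns = m ∷ ms} (there n∈ms) = ≤-trans (∈⇒≤sum n∈ms) (m≤n+m (sum ms) m)

sum-pos : ∀ ns → 0 < sum ns → ∃ λ n → n ∈ ns × 0 < n
sum-pos (zero ∷ ns) pos with sum-pos ns pos
... | n , n∈ns , n-pos = n , there n∈ns , n-pos
sum-pos (suc m ∷ ns) _ = suc m , here refl , s≤s z≤n

ΣFin-≥ : ∀ n (f : Fin n → ℕ) x → f x ≤ ΣFin n f
ΣFin-≥ n f x = ∈⇒≤sum (∈-map⁺ f (∈-allFin x))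

ΣFin-pos : ∀ n (f : Fin n → ℕ) → 0 < ΣFin n f → ∃ λ x → 0 < f x
ΣFin-pos n f pos with sum-pos (map f (allFin n)) pos
... | _ , fx∈ , fx-pos with ∈-map⁻ f fx∈
... | x , _ , refl = x , fx-pos

module MergeMap {m} (i j : Fin (suc m)) (i≢j : i ≢ j) where

  μ : Fin (suc m) → Fin m
  μ = mergeMap i j i≢j

  section-≢ : ∀ {x} → x ≢ j → punchIn j (μ x) ≡ x
  section-≢ {x} x≢j with x ≟ j
  ... | yes x≡j = ⊥-elim (x≢j x≡j)
  ... | no _ = punchIn-punchOut _

  section-j : punchIn j (μ j) ≡ i
  section-j with j ≟ j
  ... | yes _ = punchIn-punchOut _
  ... | no j≢j = ⊥-elim (j≢j refl)

  μ-punchIn : ∀ u → μ (punchIn j u) ≡ u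
  μ-punchIn u = punchIn-injective j _ _ (section-≢ (punchInᵢ≢i j u))

  μ-fibre : ∀ {x y} → μ x ≡ μ y → x ≡ y ⊎ (x ≡ i × y ≡ j) ⊎ (x ≡ j × y ≡ i)
  μ-fibre {x} {y} μx≡μy = cases (x ≟ j) (y ≟ j)
    where
    open ≡-Reasoning
    back : ∀ x′ y′ → x′ ≢ j → μ x′ ≡ μ y′ → x′ ≡ punchIn j (μ y′)
    back x′ y′ x′≢j μx′≡μy′ = trans (sym (section-≢ x′≢j)) (cong (punchIn j) μx′≡μy′)

    cases : Dec (x ≡ j) → Dec (y ≡ j) → x ≡ y ⊎ (x ≡ i × y ≡ j) ⊎ (x ≡ j × y ≡ i)
    cases (yes x≡j) (yes y≡j) = inj₁ (trans x≡j (sym y≡j))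
    cases (yes x≡j) (no y≢j) = inj₂ (inj₂ (x≡j , (begin
      y                 ≡⟨ back y x y≢j (sym μx≡μy) ⟩
      punchIn j (μ x)   ≡⟨ cong (punchIn j ∘ μ) x≡j ⟩
      punchIn j (μ j)   ≡⟨ section-j ⟩
      i                 ∎)))
    cases (no x≢j) (yes y≡j) = inj₂ (inj₁ ((begin
      x                 ≡⟨ back x y x≢j μx≡μy ⟩
      punchIn j (μ y)   ≡⟨ cong (punchIn j ∘ μ) y≡j ⟩
      punchIn j (μ j)   ≡⟨ section-j ⟩
      i                 ∎) , y≡j))
    cases (no x≢j) (no y≢j) = inj₁ (trans (back x y x≢j μx≡μy) (section-≢ y≢j))

  factor : ∀ {A : Set} (c : Fin (suc m) → A) → c i ≡ c j → ∀ x → c (punchIn j (μ x)) ≡ c x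
  factor c ci≡cj x with x ≟ j
  ... | yes x≡j = trans (cong c (punchIn-punchOut _)) (trans ci≡cj (cong c (sym x≡j)))
  ... | no _ = cong c (punchIn-punchOut _)

Loopless : ∀ {n} → Mult n → Set
Loopless {n} G = ∀ (x : Fin n) → ¬ Adj G x x

IsGraph⇒symmetric : ∀ {n} {G : Mult n} → IsGraph G → Symmetric (Adj G)
IsGraph⇒symmetric (sym-mult , _) {x} {y} = subst (0 <_) (sym-mult x y)

IsGraph⇒loopless : ∀ {n} {G : Mult n} → IsGraph G → Loopless G
IsGraph⇒loopless (_ , no-loops) x a with subst (0 <_) (no-loops x) a
... | ()

adj? : ∀ {n} (G : Mult n) x y → Dec (Adj G x y)
adj? G x y = 0 <? G x y

module Merge {m} (G : Mult (suc m)) (i j : Fin (suc m)) (i≢j : i ≢ j) where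
  open MergeMap i j i≢j public

  G/ : Mult m
  G/ = merge G i j i≢j

  -- the contribution of the edges between x and y to the multiplicity of uv
  private
    cell : Fin m → Fin m → Fin (suc m) → Fin (suc m) → ℕ
    cell u v x y = if does (μ x ≟ u) then (if does (μ y ≟ v) then G x y else 0) else 0

    cell-diag : ∀ x y → cell (μ x) (μ y) x y ≡ G x y
    cell-diag x y with μ x ≟ μ x | μ y ≟ μ y
    ... | yes _ | yes _ = refl
    ... | no μx≢μx | _ = ⊥-elim (μx≢μx refl)
    ... | yes _ | no μy≢μy = ⊥-elim (μy≢μy refl)

    cell-pos : ∀ u v x y → 0 < cell u v x y → μ x ≡ u × μ y ≡ v × Adj G x y
    cell-pos u v x y pos with μ x ≟ u | μ y ≟ v
    cell-pos u v x y pos | yes μx≡u | yes μy≡v = μx≡u , μy≡v , pos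
    cell-pos u v x y () | yes _ | no _
    cell-pos u v x y () | no _ | _

  merge-adj⁺ : ∀ {x y} → Adj G x y → Adj G/ (μ x) (μ y)
  merge-adj⁺ {x} {y} a =
    <-≤-trans (subst (0 <_) (sym (cell-diag x y)) a)
      (≤-trans (ΣFin-≥ (suc m) (cell (μ x) (μ y) x) y)
               (ΣFin-≥ (suc m) (λ x′ → ΣFin (suc m) (cell (μ x) (μ y) x′)) x))

  merge-adj⁻ : ∀ {u v} → Adj G/ u v → ∃₂ λ x y → μ x ≡ u × μ y ≡ v × Adj G x y
  merge-adj⁻ {u} {v} a with ΣFin-pos (suc m) _ a
  ... | x , a-x with ΣFin-pos (suc m) _ a-x
  ... | y , a-xy = x , y , cell-pos u v x y a-xy

  merge-adj-elim : (P : Fin m → Fin m → Set) → (∀ {x y} → Adj G x y → P (μ x) (μ y)) →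
    ∀ {u v} → Adj G/ u v → P u v
  merge-adj-elim P P-image a =
    let (x , y , μx≡u , μy≡v , axy) = merge-adj⁻ a in subst₂ P μx≡u μy≡v (P-image axy)

module _ {m} {G : Mult (suc m)} {i j : Fin (suc m)} (i≢j : i ≢ j) where
  open Merge G i j i≢j

  merge-symmetric : Symmetric (Adj G) → Symmetric (Adj G/)
  merge-symmetric sym-G = merge-adj-elim (λ u v → Adj G/ v u) (merge-adj⁺ ∘ sym-G)

  -- a loop could only come from an edge between i and j
  merge-loopless : Symmetric (Adj G) → Loopless G → ¬ Adj G i j → Loopless G/
  merge-loopless sym-G loopless-G ¬aij u a = merge-adj-elim (λ u v → u ≢ v) distinct a refl
    where
    distinct : ∀ {x y} → Adj G x y → μ x ≢ μ y
    distinct {x} {y} axy μx≡μy with μ-fibre {x} {y} μx≡μy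
    ... | inj₁ refl = loopless-G x axy
    ... | inj₂ (inj₁ (refl , refl)) = ¬aij axy
    ... | inj₂ (inj₂ (refl , refl)) = ¬aij (sym-G axy)

  merge-reach : ∀ {x y} → Reach G x y → Reach G/ (μ x) (μ y)
  merge-reach here = here
  merge-reach (step a r) = step (merge-adj⁺ a) (merge-reach r)

  merge-connected : Connected G → Connected G/
  merge-connected conn u v =
    subst₂ (Reach G/) (μ-punchIn u) (μ-punchIn v) (merge-reach (conn (punchIn j u) (punchIn j v)))

  colouring-pullback : ∀ {k} → ProperColouring G/ k → ProperColouring G k
  colouring-pullback (c , proper) = c ∘ μ , λ x y a → proper (μ x) (μ y) (merge-adj⁺ a)

  colouring-descend : ∀ {k} (col : ProperColouring G k) → proj₁ col i ≡ proj₁ col j →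
    ProperColouring G/ k
  colouring-descend (c , proper) ci≡cj = c ∘ punchIn j , proper/
    where
    proper/ : ∀ u v → Adj G/ u v → c (punchIn j u) ≢ c (punchIn j v)
    proper/ u v = merge-adj-elim (λ u v → c (punchIn j u) ≢ c (punchIn j v)) λ {x} {y} axy same →
      proper x y axy (trans (sym (factor c ci≡cj x)) (trans same (factor c ci≡cj y)))

folding-pullback : ∀ {n m} {G : Mult n} {H : Mult m} → Folding G H →
  ∀ {k} → ProperColouring H k → ProperColouring G k
folding-pullback fold-refl col = col
folding-pullback (fold-step _ _ _ d f) col = colouring-pullback (proj₁ d) (folding-pullback f col)

folding-loopless : ∀ {n m} {G : Mult n} {H : Mult m} → Folding G H →
  Symmetric (Adj G) → Loopless G → Loopless H
folding-loopless fold-refl _ loopless = loopless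
folding-loopless (fold-step _ _ _ (i≢j , ¬aij , _) f) sym-G loopless =
  folding-loopless f (merge-symmetric i≢j sym-G) (merge-loopless i≢j sym-G loopless ¬aij)

identity-colouring : ∀ {n} {G : Mult n} → Loopless G → ProperColouring G n
identity-colouring {G = G} loopless = (λ x → x) , λ x y a x≡y → loopless x (subst (Adj G x) (sym x≡y) a)

folding-colouring : ∀ {n m} {G : Mult n} {H : Mult m} →
  Symmetric (Adj G) → Loopless G → Folding G H → ProperColouring G m
folding-colouring sym-G loopless f = folding-pullback f (identity-colouring (folding-loopless f sym-G loopless))

-- A proper colouring of a complete graph is injective.
complete-colouring-≥ : ∀ {m k} {H : Mult m} → Complete H → ProperColouring H k → m ≤ k
complete-colouring-≥ complete (c , proper) = injective⇒≤ injective
  where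
  injective : ∀ {x y} → c x ≡ c y → x ≡ y
  injective {x} {y} cx≡cy with x ≟ y
  ... | yes x≡y = x≡y
  ... | no x≢y = ⊥-elim (proper x y (complete x y x≢y) cx≡cy)

complete? : ∀ {n} (G : Mult n) → Dec (Complete G)
complete? G = all? λ x → all? λ y → ¬? (x ≟ y) →-dec adj? G x y

missing-edge : ∀ {n} {G : Mult n} → ¬ Complete G → ∃₂ λ x y → x ≢ y × ¬ Adj G x y
missing-edge {n} {G} ¬complete
  with ¬∀⟶∃¬ n _ (λ x → all? λ y → ¬? (x ≟ y) →-dec adj? G x y) ¬complete
... | x , ¬complete-x with ¬∀⟶∃¬ n _ (λ y → ¬? (x ≟ y) →-dec adj? G x y) ¬complete-x
... | y , ¬complete-xy =
  x , y , (λ x≡y → ¬complete-xy λ x≢y → ⊥-elim (x≢y x≡y)) , (λ a → ¬complete-xy λ _ → a)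

N[_]_∋_ : ∀ {n} → Mult n → Fin n → Fin n → Set
N[ G ] x ∋ y = y ≡ x ⊎ Adj G x y

leave-neighbourhood : ∀ {n} {G : Mult n} {x y z} → N[ G ] x ∋ y → ¬ N[ G ] x ∋ z →
  Reach G y z → ∃₂ (Dist2 G)
leave-neighbourhood y∈N z∉N here = ⊥-elim (z∉N y∈N)
leave-neighbourhood {G = G} {x} y∈N z∉N (step {k = y′} ayy′ r) with (y′ ≟ x) ⊎-dec adj? G x y′
... | yes y′∈N = leave-neighbourhood y′∈N z∉N r
... | no y′∉N with y∈N
... | inj₁ refl = ⊥-elim (y′∉N (inj₂ ayy′))
... | inj₂ axy = x , y′ , (λ x≡y′ → y′∉N (inj₁ (sym x≡y′))) , (λ axy′ → y′∉N (inj₂ axy′)) , _ , axy , ayy′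

non-complete-dist2 : ∀ {n} {G : Mult n} → Connected G → ¬ Complete G → ∃₂ (Dist2 G)
non-complete-dist2 conn ¬complete with missing-edge ¬complete
... | x , y , x≢y , ¬axy =
  leave-neighbourhood (inj₁ refl) (λ { (inj₁ y≡x) → x≢y (sym y≡x) ; (inj₂ axy) → ¬axy axy }) (conn x y)

MonochromaticDist2 : ∀ {n k} → Mult n → (Fin n → Fin k) → Set
MonochromaticDist2 {n} G c = Σ (Fin n) λ p → Σ (Fin n) λ q → Σ (Dist2 G p q) λ _ → c p ≡ c q

module Recolouring {n k} {G : Mult n} (sym-G : Symmetric (Adj G))
  (c : Fin n → Fin k) (proper : ∀ x y → Adj G x y → c x ≢ c y)
  {u w : Fin n} (d : Dist2 G u w) where

  a b : Fin k
  a = c u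
  b = c w

  Clash : Set
  Clash = ∃ λ z → z ≢ w × c z ≡ b × ∃ λ x → Adj G w x × Adj G x z

  clash? : Dec Clash
  clash? = any? λ z → ¬? (z ≟ w) ×-dec (c z ≟ b) ×-dec any? λ x → adj? G w x ×-dec adj? G x z

  -- such a vertex is at distance exactly 2 from w, since it is not adjacent to w
  clash-monochromatic : Clash → MonochromaticDist2 G c
  clash-monochromatic (z , z≢w , cz≡b , x , awx , axz) =
    w , z , ((λ w≡z → z≢w (sym w≡z)) , (λ awz → proper w z awz (sym cz≡b)) , x , awx , axz) , sym cz≡b

  data Role (v : Fin n) : Set where
    centre  : v ≡ w → Role v
    shifted : v ≢ w → Adj G w v → c v ≡ a → Role v
    fixed   : v ≢ w → ¬ (Adj G w v × c v ≡ a) → Role v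

  role : ∀ v → Role v
  role v with v ≟ w | adj? G w v ×-dec (c v ≟ a)
  ... | yes v≡w | _ = centre v≡w
  ... | no v≢w | yes (awv , cv≡a) = shifted v≢w awv cv≡a
  ... | no v≢w | no ¬shifted = fixed v≢w ¬shifted

  newColour : ∀ {v} → Role v → Fin k
  newColour (centre _) = a
  newColour (shifted _ _ _) = b
  newColour {v} (fixed _ _) = c v

  c′ : Fin n → Fin k
  c′ v = newColour (role v)

  c′-u : c′ u ≡ a
  c′-u with role u
  ... | centre u≡w = ⊥-elim (proj₁ d u≡w)
  ... | shifted _ awu _ = ⊥-elim (proj₁ (proj₂ d) (sym-G awu))
  ... | fixed _ _ = refl

  c′-w : c′ w ≡ a
  c′-w with role w
  ... | centre _ = refl
  ... | shifted w≢w _ _ = ⊥-elim (w≢w refl)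
  ... | fixed w≢w _ = ⊥-elim (w≢w refl)

  c′-proper : a ≢ b → ¬ Clash → ∀ x y → Adj G x y → c′ x ≢ c′ y
  c′-proper a≢b ¬clash x y axy with role x | role y
  ... | centre refl | centre refl = λ _ → proper x x axy refl
  ... | centre refl | shifted _ _ _ = a≢b
  ... | centre refl | fixed _ ¬shifted = λ a≡cy → ¬shifted (axy , sym a≡cy)
  ... | shifted _ _ _ | centre refl = a≢b ∘ sym
  ... | fixed _ ¬shifted | centre refl = λ cx≡a → ¬shifted (sym-G axy , cx≡a)
  ... | shifted _ _ cx≡a | shifted _ _ cy≡a = λ _ → proper x y axy (trans cx≡a (sym cy≡a))
  ... | shifted _ awx _ | fixed y≢w _ = λ b≡cy → ¬clash (y , y≢w , sym b≡cy , x , awx , axy)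
  ... | fixed x≢w _ | shifted _ awy _ = λ cx≡b → ¬clash (x , x≢w , cx≡b , y , awy , sym-G axy)
  ... | fixed _ _ | fixed _ _ = proper x y axy

  recolour : Σ (ProperColouring G k) λ col → MonochromaticDist2 G (proj₁ col)
  recolour with a ≟ b | clash?
  ... | yes a≡b | _ = (c , proper) , u , w , d , a≡b
  ... | no _ | yes clash = (c , proper) , clash-monochromatic clash
  ... | no a≢b | no ¬clash = (c′ , c′-proper a≢b ¬clash) , u , w , d , trans c′-u (sym c′-w)

CompleteColouredFolding : ∀ {n} → Mult n → ℕ → Set
CompleteColouredFolding G k =
  Σ ℕ λ m → Σ (Mult m) λ H → Folding G H × Complete H × ProperColouring H k

fold-step-complete : ∀ {m k} {G : Mult (suc m)} → ¬ Complete G → ∀ p q (d : Dist2 G p q) →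
  CompleteColouredFolding (merge G p q (proj₁ d)) k → CompleteColouredFolding G k
fold-step-complete ¬complete p q d (m′ , H , f , complete , colH) =
  m′ , H , fold-step ¬complete p q d f , complete , colH

fold-to-complete : ∀ n (G : Mult n) {k} → Symmetric (Adj G) → Connected G →
  ProperColouring G k → CompleteColouredFolding G k
fold-to-complete zero G _ _ col = zero , G , fold-refl , (λ ()) , col
fold-to-complete (suc m) G {k} sym-G conn (c , proper) with complete? G
... | yes complete = suc m , G , fold-refl , complete , (c , proper)
... | no ¬complete =
  merge-monochromatic (Recolouring.recolour sym-G c proper (proj₂ (proj₂ (non-complete-dist2 conn ¬complete))))
  where
  merge-monochromatic : Σ (ProperColouring G k) (λ col → MonochromaticDist2 G (proj₁ col)) →
    CompleteColouredFolding G k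
  merge-monochromatic (col , p , q , d , cp≡cq) = fold-step-complete ¬complete p q d
    (fold-to-complete m (merge G p q (proj₁ d)) (merge-symmetric (proj₁ d) sym-G)
      (merge-connected (proj₁ d) conn) (colouring-descend (proj₁ d) col cp≡cq))

-- The chromatic number exists: colourability is decidable and ℕ is
-- well-ordered.

∃-function? : ∀ n k (P : (Fin n → Fin k) → Set) → (∀ {f g} → f ≗ g → P f → P g) →
  Decidable P → Dec (∃ P)
∃-function? zero k P resp P? =
  map′ (λ p → empty , p) (λ (f , p) → resp {f} {empty} (λ ()) p) (P? empty)
  where
  empty : Fin 0 → Fin k
  empty ()
∃-function? (suc n) k P resp P? =
  map′ (λ (x , g , p) → x ◂ g , p)
       (λ (f , p) → f Fin.zero , f ∘ Fin.suc , resp (λ { Fin.zero → refl ; (Fin.suc _) → refl }) p)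
       (any? λ x → ∃-function? n k (P ∘ (x ◂_))
          (λ g≗g′ → resp (λ { Fin.zero → refl ; (Fin.suc y) → g≗g′ y })) (P? ∘ (x ◂_)))

colourable? : ∀ {n} (G : Mult n) k → Dec (ProperColouring G k)
colourable? {n} G k = ∃-function? n k _ proper-resp
  (λ c → all? λ x → all? λ y → adj? G x y →-dec ¬? (c x ≟ c y))
  where
  proper-resp : ∀ {f g} → f ≗ g → (∀ x y → Adj G x y → f x ≢ f y) → ∀ x y → Adj G x y → g x ≢ g y
  proper-resp f≗g proper x y a gx≡gy = proper x y a (trans (f≗g x) (trans gx≡gy (sym (f≗g y))))

Least : (ℕ → Set) → Set
Least Q = Σ ℕ λ k → Q k × (∀ k′ → Q k′ → k ≤ k′)

least : (Q : ℕ → Set) → Decidable Q → ∀ b → Q b → Least Q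
least Q Q? = <-rec (λ b → Q b → Least Q) search
  where
  search : ∀ b → (∀ {k} → k < b → Q k → Least Q) → Q b → Least Q
  search b smaller qb with any? (λ (k : Fin b) → Q? (toℕ k))
  ... | yes (k , qk) = smaller (toℕ<n k) qk
  ... | no none = b , qb , λ k′ qk′ →
    ≮⇒≥ λ k′<b → none (fromℕ< k′<b , subst Q (sym (toℕ-fromℕ< k′<b)) qk′)

theorem1 : ∀ (n : ℕ) (G : Mult n) → IsGraph G → Connected G →
    Σ ℕ (λ k → IsFoldingNumber G k × IsChromaticNumber G k)
theorem1 n G graph conn
  with least (ProperColouring G) (colourable? G) n (identity-colouring (IsGraph⇒loopless graph))
... | χ , colχ , χ-minimal
  with fold-to-complete n G (IsGraph⇒symmetric graph) conn colχ
... | m , H , f , complete , colH =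
  m , ((H , f , complete) , λ k′ (_ , f′ , _) → bound k′ (colouring-of f′))
    , (colouring-of f , bound)
  where
  colouring-of : ∀ {k} {H′ : Mult k} → Folding G H′ → ProperColouring G k
  colouring-of = folding-colouring (IsGraph⇒symmetric graph) (IsGraph⇒loopless graph)

  bound : ∀ k′ → ProperColouring G k′ → m ≤ k′
  bound k′ col = ≤-trans (complete-colouring-≥ complete colH) (χ-minimal k′ col)
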